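{- Let $n\ge3$ be an integer and let $f$ be a $\gamma_{tr3}(P_3\square P_n)$-function such that the number of vertices $v$ with $f(v)=\emptyset$ is minimum among all $\gamma_{tr3}(P_3\square P_n)$-functions. If $j\in\{0,1,\dots,n-1\}$ satisfies $|f((1,j))|=1$, then $|f((2,j))|=1$.
   Context: $P_m$ denotes the directed path with vertex set $\{0,1,\dots,m-1\}$ and arcs $(i,i+1)$ for $0\le i\le m-2$. The Cartesian product $D_1\square D_2$ has vertex set $V(D_1)\times V(D_2)$, with an arc from $(x_1,y_1)$ to $(x_2,y_2)$ iff either $(x_1,x_2)$ is an arc of $D_1$ and $y_1=y_2$, or $x_1=x_2$ and $(y_1,y_2)$ is an arc of $D_2$; so vertices of $P_3\square P_n$ are $(i,j)$ with $i\in\{0,1,2\}$, $j\in\{0,\dots,n-1\}$. For a digraph $D$ and positive integer $k$, a $k$RDF is a function $f:V(D)\to\mathcal{P}(\{1,\dots,k\})$ such that every $v$ with $f(v)=\emptyset$ satisfies $\bigcup_{u\in N^-(v)}f(u)=\{1,\dots,k\}$ ($N^-(v)$ the in-neighbors of $v$); its weight is $\sum_v|f(v)|$. A T$k$RDF is a $k$RDF $f$ such that the subdigraph induced by $\{v:f(v)\neq\emptyset\}$ has no isolated vertex; $\gamma_{trk}(D)$ is the minimum weight of a T$k$RDF, and a T$k$RDF of that weight is a $\gamma_{trk}(D)$-function. -}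

module Defs where

open import Data.Nat using (ℕ; suc; _≤_; _≡ᵇ_)
open import Data.Fin using (Fin; toℕ)
open import Data.Fin.Subset using (Subset; ⊥; _∈_; ∣_∣)
open import Data.List using (List; map; allFin)
open import Data.Nat.ListAction using (sum)
open import Data.Vec.Properties using (≡-dec)
open import Data.Bool.Properties using () renaming (_≟_ to _≟B_)
open import Relation.Nullary.Decidable using (does)
open import Data.Bool using (if_then_else_)
open import Data.Product using (_×_; ∃; ∃-syntax)
open import Data.Sum using (_⊎_)
open import Relation.Binary.PropositionalEquality using (_≡_; _≢_)

-- Vertices of P_m □ P_n : pairs (i , j) with i : Fin m, j : Fin n.
-- Labelings f : V → P({1..k}) are curried: f i j : Subset k  (colour c ↔ Fin k).

Arc : {m n : ℕ} → Fin m → Fin n → Fin m → Fin n → Set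
Arc i j i' j' = (toℕ i' ≡ suc (toℕ i) × j ≡ j') ⊎ (i ≡ i' × toℕ j' ≡ suc (toℕ j))

Labeling : ℕ → ℕ → ℕ → Set
Labeling m n k = Fin m → Fin n → Subset k

IsKRDF : {m n k : ℕ} → Labeling m n k → Set
IsKRDF {m} {n} {k} f =
  ∀ (i : Fin m) (j : Fin n) → f i j ≡ ⊥ →
    ∀ (c : Fin k) → ∃[ i' ] ∃[ j' ] (Arc i' j' i j × c ∈ f i' j')

IsTKRDF : {m n k : ℕ} → Labeling m n k → Set
IsTKRDF {m} {n} {k} f =
  IsKRDF f ×
  (∀ (i : Fin m) (j : Fin n) → f i j ≢ ⊥ →
     ∃[ i' ] ∃[ j' ] ((Arc i' j' i j ⊎ Arc i j i' j') × f i' j' ≢ ⊥))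

sumV : {m n : ℕ} → (Fin m → Fin n → ℕ) → ℕ
sumV {m} {n} g = sum (map (λ i → sum (map (λ j → g i j) (allFin n))) (allFin m))

weight : {m n k : ℕ} → Labeling m n k → ℕ
weight f = sumV (λ i j → ∣ f i j ∣)

emptyCount : {m n k : ℕ} → Labeling m n k → ℕ
emptyCount f = sumV (λ i j → if does (≡-dec _≟B_ (f i j) ⊥) then 1 else 0)

IsGammaTRK : {m n k : ℕ} → Labeling m n k → Set
IsGammaTRK {m} {n} {k} f =
  IsTKRDF f × (∀ (g : Labeling m n k) → IsTKRDF g → weight f ≤ weight g)

IsMinEmptyGamma : {m n k : ℕ} → Labeling m n k → Set
IsMinEmptyGamma {m} {n} {k} f =
  IsGammaTRK f × (∀ (g : Labeling m n k) → IsGammaTRK g → emptyCount f ≤ emptyCount g)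

-- Let v = (2,j), the bottom-row vertex below (1,j). If f(v) = ∅, the two colours missing at
-- (1,j) can only reach v from its left neighbour (2,j-1), which therefore carries at least two
-- colours. If |f(v)| ≥ 2, v itself is such a heavy bottom-row vertex. A heavy vertex u of the
-- bottom row has a single out-neighbour w = (2,·+1), if any. If w is empty, relabelling both u
-- and w by the same singleton keeps the weight and the totality but removes an empty vertex;
-- otherwise relabelling u alone by a singleton gives a lighter T3RDF. Both contradict the choice
-- of f.
module Submission where

open import Defs
open import Data.Nat using (ℕ; _≤_)
open import Data.Fin using (Fin)
open import Data.Fin.Subset using (∣_∣)
open import Relation.Binary.PropositionalEquality using (_≡_)

open import Data.Nat using (suc; _+_; _∸_; _<_; z≤n; s≤s; z<s)
open import Data.Nat.Properties
open import Data.Nat.Tactic.RingSolver using (solve-∀)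
open import Data.Fin using (toℕ) renaming (zero to fzero; suc to fsuc)
open import Data.Fin.Properties using (toℕ-injective)
  renaming (_≟_ to _≟F_; suc-injective to fsuc-injective)
open import Data.Fin.Subset using (Subset; ⊥; _∈_; _∉_; _⊆_; ∁; ⁅_⁆; Nonempty; outside)
open import Data.Fin.Subset.Properties
  using (∉⊥; ∣⁅x⁆∣≡1; ∣⊥∣≡0; ∣∁p∣≡n∸∣p∣; p⊆q⇒∣p∣≤∣q∣; x∈∁p⇒x∉p; nonempty?; Empty-unique)
open import Data.Vec using ([]; _∷_)
open import Data.Vec.Properties using (≡-dec)
open import Data.Bool using (if_then_else_)
open import Data.Bool.Properties using () renaming (_≟_ to _≟B_)
open import Data.List using (map; allFin)
open import Data.List.Properties using (map-tabulate; map-cong)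
open import Data.Nat.ListAction using (sum)
open import Data.Product.Properties using () renaming (≡-dec to ×-≡-dec)
open import Data.Product using (_×_; _,_; proj₁; proj₂; ∃-syntax)
open import Data.Sum using (_⊎_; inj₁; inj₂; [_,_]′)
open import Function using (_∘_)
open import Relation.Nullary using (¬_; yes; no; does; contradiction)
open import Relation.Binary.PropositionalEquality
  using (_≢_; refl; sym; trans; cong; cong₂; subst; module ≡-Reasoning)

private variable
  m n k : ℕ

pattern i₁ = fsuc fzero
pattern i₂ = fsuc (fsuc fzero)

+-exchange-trans : ∀ {x x′ r r′ y y′ : ℕ} →
  x′ + r ≡ x + r′ → r′ + y ≡ r + y′ → x′ + y ≡ x + y′
+-exchange-trans {x} {x′} {r} {r′} {y} {y′} e₁ e₂ = +-cancelʳ-≡ (r + r′) _ _ (begin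
  (x′ + y) + (r + r′)  ≡⟨ shuffle x′ y r r′ ⟩
  (x′ + r) + (r′ + y)  ≡⟨ cong₂ _+_ e₁ e₂ ⟩
  (x + r′) + (r + y′)  ≡⟨ sym (shuffle x y′ r′ r) ⟩
  (x + y′) + (r′ + r)  ≡⟨ cong ((x + y′) +_) (+-comm r′ r) ⟩
  (x + y′) + (r + r′)  ∎)
  where
  open ≡-Reasoning
  shuffle : ∀ a b c d → (a + b) + (c + d) ≡ (a + c) + (d + b)
  shuffle = solve-∀

+≡+⇒≤ : ∀ {a b s t} → a + s ≡ b + t → t ≤ s → a ≤ b
+≡+⇒≤ {a} {b} {s} {t} eq t≤s =
  +-cancelʳ-≤ t a b (≤-trans (+-monoʳ-≤ a t≤s) (≤-reflexive eq))

+≡+⇒< : ∀ {a b s t} → a + s ≡ b + t → t < s → a < b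
+≡+⇒< {a} {b} {s} {t} eq t<s =
  +-cancelʳ-≤ t (suc a) b
    (≤-trans (≤-reflexive (sym (+-suc a t))) (≤-trans (+-monoʳ-≤ a t<s) (≤-reflexive eq)))

sumFin : (Fin n → ℕ) → ℕ
sumFin {n} h = sum (map h (allFin n))

sumFin-cong : {g h : Fin n → ℕ} → (∀ x → g x ≡ h x) → sumFin g ≡ sumFin h
sumFin-cong {n} eq = cong sum (map-cong eq (allFin n))

sumFin-suc : (h : Fin (suc n) → ℕ) → sumFin h ≡ h fzero + sumFin (h ∘ fsuc)
sumFin-suc {n} h = cong (λ xs → h fzero + sum xs)
  (trans (map-tabulate fsuc h) (sym (map-tabulate (λ x → x) (h ∘ fsuc))))

sumFin-exchange : (g g′ : Fin n → ℕ) (a : Fin n) → (∀ x → x ≢ a → g′ x ≡ g x) →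
  sumFin g′ + g a ≡ sumFin g + g′ a
sumFin-exchange g g′ fzero agree = begin
  sumFin g′ + g fzero                          ≡⟨ cong (_+ g fzero) (sumFin-suc g′) ⟩
  (g′ fzero + sumFin (g′ ∘ fsuc)) + g fzero    ≡⟨ cong (λ s → (g′ fzero + s) + g fzero) tails ⟩
  (g′ fzero + sumFin (g ∘ fsuc)) + g fzero     ≡⟨ swap (g′ fzero) (sumFin (g ∘ fsuc)) (g fzero) ⟩
  (g fzero + sumFin (g ∘ fsuc)) + g′ fzero     ≡⟨ cong (_+ g′ fzero) (sym (sumFin-suc g)) ⟩
  sumFin g + g′ fzero                          ∎
  where
  open ≡-Reasoning
  tails = sumFin-cong (λ x → agree (fsuc x) λ ())
  swap : ∀ a s b → (a + s) + b ≡ (b + s) + a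
  swap = solve-∀
sumFin-exchange g g′ (fsuc a) agree = begin
  sumFin g′ + g (fsuc a)                           ≡⟨ cong (_+ g (fsuc a)) (sumFin-suc g′) ⟩
  (g′ fzero + sumFin (g′ ∘ fsuc)) + g (fsuc a)     ≡⟨ +-assoc (g′ fzero) _ _ ⟩
  g′ fzero + (sumFin (g′ ∘ fsuc) + g (fsuc a))     ≡⟨ cong₂ _+_ (agree fzero λ ()) tails ⟩
  g fzero + (sumFin (g ∘ fsuc) + g′ (fsuc a))      ≡⟨ sym (+-assoc (g fzero) _ _) ⟩
  (g fzero + sumFin (g ∘ fsuc)) + g′ (fsuc a)      ≡⟨ cong (_+ g′ (fsuc a)) (sym (sumFin-suc g)) ⟩
  sumFin g + g′ (fsuc a)                           ∎
  where
  open ≡-Reasoning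
  tails = sumFin-exchange (g ∘ fsuc) (g′ ∘ fsuc) a (λ x x≢a → agree (fsuc x) (x≢a ∘ fsuc-injective))

sumV-exchange : (G G′ : Fin m → Fin n → ℕ) (a : Fin m) (b : Fin n) →
  (∀ i j → (i , j) ≢ (a , b) → G′ i j ≡ G i j) →
  sumV G′ + G a b ≡ sumV G + G′ a b
sumV-exchange G G′ a b agree = +-exchange-trans {sumV G} rows row-a
  where
  rows : sumV G′ + sumFin (G a) ≡ sumV G + sumFin (G′ a)
  rows = sumFin-exchange (sumFin ∘ G) (sumFin ∘ G′) a
    (λ i i≢a → sumFin-cong (λ j → agree i j (i≢a ∘ cong proj₁)))
  row-a : sumFin (G′ a) + G a b ≡ sumFin (G a) + G′ a b
  row-a = sumFin-exchange (G a) (G′ a) b (λ j j≢b → agree a j (j≢b ∘ cong proj₂))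

update : Labeling m n k → Fin m → Fin n → Subset k → Labeling m n k
update f i j L i′ j′ = if does (×-≡-dec _≟F_ _≟F_ (i′ , j′) (i , j)) then L else f i′ j′

module _ (f : Labeling m n k) (i : Fin m) (j : Fin n) (L : Subset k) where

  update-same : update f i j L i j ≡ L
  update-same with ×-≡-dec _≟F_ _≟F_ (i , j) (i , j)
  ... | yes _ = refl
  ... | no ne = contradiction refl ne

  update-other : ∀ {i′ j′} → (i′ , j′) ≢ (i , j) → update f i j L i′ j′ ≡ f i′ j′
  update-other {i′} {j′} ne with ×-≡-dec _≟F_ _≟F_ (i′ , j′) (i , j)
  ... | yes eq = contradiction eq ne
  ... | no _ = refl

  sumV-update : (h : Subset k → ℕ) →
    sumV (λ i′ j′ → h (update f i j L i′ j′)) + h (f i j) ≡ sumV (λ i′ j′ → h (f i′ j′)) + h L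
  sumV-update h = trans (sumV-exchange _ _ i j (λ _ _ → cong h ∘ update-other))
                        (cong (λ p → _ + h p) update-same)

-- Chosen so that emptyCount f unfolds to the sum of emptiness (f i j).
emptiness : Subset k → ℕ
emptiness p = if does (≡-dec _≟B_ p ⊥) then 1 else 0

emptiness-⊥ : emptiness (⊥ {k}) ≡ 1
emptiness-⊥ {k} with ≡-dec _≟B_ (⊥ {k}) ⊥
... | yes _ = refl
... | no ne = contradiction refl ne

weight-update : (f : Labeling m n k) (i : Fin m) (j : Fin n) (L : Subset k) →
  weight (update f i j L) + ∣ f i j ∣ ≡ weight f + ∣ L ∣
weight-update f i j L = sumV-update f i j L ∣_∣

emptyCount-update : (f : Labeling m n k) (i : Fin m) (j : Fin n) (L : Subset k) →
  emptyCount (update f i j L) + emptiness (f i j) ≡ emptyCount f + emptiness L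
emptyCount-update f i j L = sumV-update f i j L emptiness

weight-update-⁅0⁆ : (f : Labeling m n (suc k)) (i : Fin m) (j : Fin n) →
  weight (update f i j ⁅ fzero ⁆) + ∣ f i j ∣ ≡ weight f + 1
weight-update-⁅0⁆ {k = k} f i j =
  trans (weight-update f i j _) (cong (weight f +_) (∣⁅x⁆∣≡1 {suc k} fzero))

0<∣p∣⇒p≢⊥ : {p : Subset k} → 0 < ∣ p ∣ → p ≢ ⊥
0<∣p∣⇒p≢⊥ {k} 0<∣p∣ refl = contradiction (∣⊥∣≡0 k) (>⇒≢ 0<∣p∣)

∣p∣≡0⇒p≡⊥ : (p : Subset k) → ∣ p ∣ ≡ 0 → p ≡ ⊥
∣p∣≡0⇒p≡⊥ [] _ = refl
∣p∣≡0⇒p≡⊥ (outside ∷ p) ∣p∣≡0 = cong (outside ∷_) (∣p∣≡0⇒p≡⊥ p ∣p∣≡0)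

⁅0⁆≢⊥ : ⁅ fzero ⁆ ≢ ⊥ {suc k}
⁅0⁆≢⊥ ()

0<∣p∣⇒Nonempty : {p : Subset k} → 0 < ∣ p ∣ → Nonempty p
0<∣p∣⇒Nonempty {p = p} 0<∣p∣ with nonempty? p
... | yes ne = ne
... | no empty = contradiction (Empty-unique empty) (0<∣p∣⇒p≢⊥ 0<∣p∣)

Adjacent : Fin m → Fin n → Fin m → Fin n → Set
Adjacent i j i′ j′ = Arc i′ j′ i j ⊎ Arc i j i′ j′

Arc-irreflexive : {i : Fin m} {j : Fin n} → ¬ Arc i j i j
Arc-irreflexive (inj₁ (e , _)) = 1+n≢n (sym e)
Arc-irreflexive (inj₂ (_ , e)) = 1+n≢n (sym e)

-- The disjunction: no empty out-neighbour of (i,j) relied on the colours (i,j) used to carry.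
relabel-isTKRDF : {f : Labeling m n k} {i : Fin m} {j : Fin n} {L : Subset k} →
  IsTKRDF f → L ≢ ⊥ →
  f i j ≡ ⊥ ⊎ (∀ {i′ j′} → Arc i j i′ j′ → f i′ j′ ≢ ⊥) →
  ∃[ i′ ] ∃[ j′ ] (Adjacent i j i′ j′ × f i′ j′ ≢ ⊥) →
  IsTKRDF (update f i j L)
relabel-isTKRDF {f = f} {i} {j} {L} (dominating , total) L≢⊥ spare (i₀ , j₀ , adj₀ , f₀≢⊥) =
  dominating′ , total′
  where
  g = update f i j L

  nonempty-kept : ∀ i′ j′ → f i′ j′ ≢ ⊥ → g i′ j′ ≢ ⊥
  nonempty-kept i′ j′ f≢⊥ with ×-≡-dec _≟F_ _≟F_ (i′ , j′) (i , j)
  ... | yes _ = L≢⊥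
  ... | no _ = f≢⊥

  unneeded : ∀ {i′ j′ c} → Arc i j i′ j′ → f i′ j′ ≡ ⊥ → c ∉ f i j
  unneeded arc empty c∈ =
    [ (λ f≡⊥ → ∉⊥ (subst (_ ∈_) f≡⊥ c∈)) , (λ out-nonempty → out-nonempty arc empty) ]′ spare

  colour-kept : ∀ {i′ j′ i″ j″ c} → Arc i″ j″ i′ j′ → f i′ j′ ≡ ⊥ → c ∈ f i″ j″ → c ∈ g i″ j″
  colour-kept {i″ = i″} {j″} arc empty c∈ with ×-≡-dec _≟F_ _≟F_ (i″ , j″) (i , j)
  ... | no _ = c∈
  ... | yes refl = contradiction c∈ (unneeded arc empty)

  dominating′ : ∀ i′ j′ → g i′ j′ ≡ ⊥ → ∀ c → ∃[ i″ ] ∃[ j″ ] (Arc i″ j″ i′ j′ × c ∈ g i″ j″)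
  dominating′ i′ j′ g≡⊥ c with ×-≡-dec _≟F_ _≟F_ (i′ , j′) (i , j)
  ... | yes _ = contradiction g≡⊥ L≢⊥
  ... | no _ with dominating i′ j′ g≡⊥ c
  ... | i″ , j″ , arc , c∈ = i″ , j″ , arc , colour-kept arc g≡⊥ c∈

  total′ : ∀ i′ j′ → g i′ j′ ≢ ⊥ → ∃[ i″ ] ∃[ j″ ] (Adjacent i′ j′ i″ j″ × g i″ j″ ≢ ⊥)
  total′ i′ j′ g≢⊥ with ×-≡-dec _≟F_ _≟F_ (i′ , j′) (i , j)
  ... | yes refl = i₀ , j₀ , adj₀ , nonempty-kept i₀ j₀ f₀≢⊥
  ... | no _ with total i′ j′ g≢⊥
  ... | i″ , j″ , adj , f≢⊥ = i″ , j″ , adj , nonempty-kept i″ j″ f≢⊥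

lighter-isGammaTRK : {f g : Labeling m n k} →
  IsGammaTRK f → IsTKRDF g → weight g ≤ weight f → IsGammaTRK g
lighter-isGammaTRK (_ , minimal) gT g≤f = gT , λ h hT → ≤-trans g≤f (minimal h hT)

out-neighbours-nonempty⇒∣f∣≤1 : {f : Labeling m n (suc k)} {i : Fin m} {j : Fin n} →
  IsGammaTRK f → (∀ {i′ j′} → Arc i j i′ j′ → f i′ j′ ≢ ⊥) → ∣ f i j ∣ ≤ 1
out-neighbours-nonempty⇒∣f∣≤1 {f = f} {i} {j} (fT , minimal) out-nonempty =
  ≮⇒≥ λ heavy → <⇒≱ (lighter heavy) (minimal g (gT heavy))
  where
  g = update f i j ⁅ fzero ⁆

  gT : 1 < ∣ f i j ∣ → IsTKRDF g
  gT heavy = relabel-isTKRDF fT ⁅0⁆≢⊥ (inj₂ out-nonempty)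
    (proj₂ fT i j (0<∣p∣⇒p≢⊥ (<-trans z<s heavy)))

  lighter : 1 < ∣ f i j ∣ → weight g < weight f
  lighter = +≡+⇒< (weight-update-⁅0⁆ f i j)

sole-out-neighbour-empty⇒∣f∣≤1 : {f : Labeling m n (suc k)} {i i′ : Fin m} {j j′ : Fin n} →
  IsMinEmptyGamma f → Arc i j i′ j′ →
  (∀ {i″ j″} → Arc i j i″ j″ → (i″ , j″) ≡ (i′ , j′)) → f i′ j′ ≡ ⊥ → ∣ f i j ∣ ≤ 1
sole-out-neighbour-empty⇒∣f∣≤1 {k = k} {f = f} {i} {i′} {j} {j′}
  (γ@(fT , _) , fewest-empty) arc sole empty =
  ≮⇒≥ λ heavy → <⇒≱ fewer-empty
    (fewest-empty g₂ (lighter-isGammaTRK γ (g₂T heavy) (not-heavier heavy)))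
  where
  g₁ = update f i′ j′ ⁅ fzero ⁆
  g₂ = update g₁ i j ⁅ fzero ⁆

  g₁-filled : g₁ i′ j′ ≢ ⊥
  g₁-filled g₁≡⊥ = ⁅0⁆≢⊥ (trans (sym (update-same f i′ j′ _)) g₁≡⊥)

  g₁-unchanged : g₁ i j ≡ f i j
  g₁-unchanged = update-other f i′ j′ _ λ { refl → Arc-irreflexive arc }

  g₁-out-nonempty : ∀ {i″ j″} → Arc i j i″ j″ → g₁ i″ j″ ≢ ⊥
  g₁-out-nonempty arc′ with sole arc′
  ... | refl = g₁-filled

  g₂T : 1 < ∣ f i j ∣ → IsTKRDF g₂
  g₂T heavy = relabel-isTKRDF g₁T ⁅0⁆≢⊥ (inj₂ g₁-out-nonempty) (i′ , j′ , inj₂ arc , g₁-filled)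
    where
    g₁T = relabel-isTKRDF fT ⁅0⁆≢⊥ (inj₁ empty) (i , j , inj₁ arc , 0<∣p∣⇒p≢⊥ (<-trans z<s heavy))

  not-heavier : 1 < ∣ f i j ∣ → weight g₂ ≤ weight f
  not-heavier = +≡+⇒≤ (begin
    weight g₂ + ∣ f i j ∣   ≡⟨ cong (λ p → weight g₂ + ∣ p ∣) (sym g₁-unchanged) ⟩
    weight g₂ + ∣ g₁ i j ∣  ≡⟨ weight-update-⁅0⁆ g₁ i j ⟩
    weight g₁ + 1           ≡⟨ cong (_+ 1) g₁-weight ⟩
    (weight f + 1) + 1      ≡⟨ +-assoc (weight f) 1 1 ⟩
    weight f + 2            ∎)
    where
    open ≡-Reasoning
    g₁-weight : weight g₁ ≡ weight f + 1
    g₁-weight = begin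
      weight g₁                ≡⟨ sym (+-identityʳ _) ⟩
      weight g₁ + 0            ≡⟨ cong (weight g₁ +_) (sym (trans (cong ∣_∣ empty) (∣⊥∣≡0 (suc k)))) ⟩
      weight g₁ + ∣ f i′ j′ ∣  ≡⟨ weight-update-⁅0⁆ f i′ j′ ⟩
      weight f + 1             ∎

  fewer-empty : emptyCount g₂ < emptyCount f
  fewer-empty = ≤-<-trans
    (+≡+⇒≤ (emptyCount-update g₁ i j _) z≤n)
    (+≡+⇒< (trans (cong (emptyCount g₁ +_) (sym f′-emptiness)) (emptyCount-update f i′ j′ _)) z<s)
    where
    f′-emptiness : emptiness (f i′ j′) ≡ 1
    f′-emptiness = trans (cong emptiness empty) (emptiness-⊥ {suc k})

row₂-in-neighbour : {i′ : Fin 3} {j′ j : Fin n} → Arc i′ j′ i₂ j →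
  (i′ ≡ i₁ × j′ ≡ j) ⊎ (i′ ≡ i₂ × toℕ j ≡ suc (toℕ j′))
row₂-in-neighbour {i′ = fzero} (inj₁ (() , _))
row₂-in-neighbour {i′ = i₁} (inj₁ (refl , refl)) = inj₁ (refl , refl)
row₂-in-neighbour {i′ = i₂} (inj₁ (() , _))
row₂-in-neighbour (inj₂ (refl , j≡1+j′)) = inj₂ (refl , j≡1+j′)

row₂-out-neighbour : {i′ : Fin 3} {a j′ : Fin n} → Arc i₂ a i′ j′ → i′ ≡ i₂ × toℕ j′ ≡ suc (toℕ a)
row₂-out-neighbour {i′ = fzero} (inj₁ (() , _))
row₂-out-neighbour {i′ = i₁} (inj₁ (() , _))
row₂-out-neighbour {i′ = i₂} (inj₁ (() , _))
row₂-out-neighbour (inj₂ (refl , j′≡1+a)) = refl , j′≡1+a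

row₂-sole-out-neighbour : {i′ : Fin 3} {a b j′ : Fin n} → toℕ b ≡ suc (toℕ a) →
  Arc i₂ a i′ j′ → (i′ , j′) ≡ (i₂ , b)
row₂-sole-out-neighbour b≡1+a arc with row₂-out-neighbour arc
... | refl , j′≡1+a = cong (i₂ ,_) (toℕ-injective (trans j′≡1+a (sym b≡1+a)))

row₂-empty-successor⇒∣f∣≤1 : {f : Labeling 3 n (suc k)} {a b : Fin n} →
  IsMinEmptyGamma f → toℕ b ≡ suc (toℕ a) → f i₂ b ≡ ⊥ → ∣ f i₂ a ∣ ≤ 1
row₂-empty-successor⇒∣f∣≤1 mg b≡1+a =
  sole-out-neighbour-empty⇒∣f∣≤1 mg (inj₂ (refl , b≡1+a)) (row₂-sole-out-neighbour b≡1+a)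

row₂-empty-colour-from-left : {f : Labeling 3 n k} {j : Fin n} {c : Fin k} →
  IsKRDF f → f i₂ j ≡ ⊥ → c ∉ f i₁ j → ∃[ j′ ] (toℕ j ≡ suc (toℕ j′) × c ∈ f i₂ j′)
row₂-empty-colour-from-left {j = j} {c} dominating empty c∉ with dominating i₂ j empty c
... | i′ , j′ , arc , c∈ with row₂-in-neighbour arc
... | inj₁ (refl , refl) = contradiction c∈ c∉
... | inj₂ (refl , j≡1+j′) = j′ , j≡1+j′ , c∈

row₂-empty⇒k∸∣above∣≤∣left∣ : {f : Labeling 3 n k} {j : Fin n} →
  IsKRDF f → f i₂ j ≡ ⊥ → ∣ f i₁ j ∣ < k →
  ∃[ j′ ] (toℕ j ≡ suc (toℕ j′) × k ∸ ∣ f i₁ j ∣ ≤ ∣ f i₂ j′ ∣)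
row₂-empty⇒k∸∣above∣≤∣left∣ {k = k} {f} {j} dominating empty ∣f₁∣<k
  with from-left (x∈∁p⇒x∉p (proj₂ (0<∣p∣⇒Nonempty missing-nonempty)))
  where
  from-left = row₂-empty-colour-from-left dominating empty
  missing-nonempty : 0 < ∣ ∁ (f i₁ j) ∣
  missing-nonempty = subst (0 <_) (sym (∣∁p∣≡n∸∣p∣ (f i₁ j))) (m<n⇒0<n∸m ∣f₁∣<k)
... | j′ , j≡1+j′ , _ = j′ , j≡1+j′ , (begin
  k ∸ ∣ f i₁ j ∣      ≡⟨ sym (∣∁p∣≡n∸∣p∣ (f i₁ j)) ⟩
  ∣ ∁ (f i₁ j) ∣      ≤⟨ p⊆q⇒∣p∣≤∣q∣ missing⊆left ⟩
  ∣ f i₂ j′ ∣         ∎)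
  where
  open ≤-Reasoning
  missing⊆left : ∁ (f i₁ j) ⊆ f i₂ j′
  missing⊆left c∈∁ with row₂-empty-colour-from-left dominating empty (x∈∁p⇒x∉p c∈∁)
  ... | j″ , j≡1+j″ , c∈ with toℕ-injective (suc-injective (trans (sym j≡1+j″) j≡1+j′))
  ... | refl = c∈

lemma4p5 : (n : ℕ) → 3 ≤ n → (f : Labeling 3 n 3) → IsMinEmptyGamma f →
    (j : Fin n) → ∣ f (Fin.suc Fin.zero) j ∣ ≡ 1 →
    ∣ f (Fin.suc (Fin.suc Fin.zero)) j ∣ ≡ 1
lemma4p5 n _ f mg j ∣f₁∣≡1 = ≤-antisym at-most-one at-least-one
  where
  no-empty-successor : 1 < ∣ f i₂ j ∣ → ∀ {i′ j′} → Arc i₂ j i′ j′ → f i′ j′ ≢ ⊥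
  no-empty-successor heavy arc empty with row₂-out-neighbour arc
  ... | refl , j′≡1+j = <⇒≱ heavy (row₂-empty-successor⇒∣f∣≤1 mg j′≡1+j empty)

  at-most-one : ∣ f i₂ j ∣ ≤ 1
  at-most-one = ≮⇒≥ λ heavy →
    <⇒≱ heavy (out-neighbours-nonempty⇒∣f∣≤1 (proj₁ mg) (no-empty-successor heavy))

  at-least-one : 1 ≤ ∣ f i₂ j ∣
  at-least-one = ≮⇒≥ λ ∣f₂∣<1 → not-empty (∣p∣≡0⇒p≡⊥ (f i₂ j) (n<1⇒n≡0 ∣f₂∣<1))
    where
    not-empty : f i₂ j ≢ ⊥
    not-empty empty with row₂-empty⇒k∸∣above∣≤∣left∣ (proj₁ (proj₁ (proj₁ mg))) empty
                           (subst (_< 3) (sym ∣f₁∣≡1) (s≤s (s≤s z≤n)))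
    ... | j′ , j≡1+j′ , bound =
      <⇒≱ (subst (λ s → 3 ∸ s ≤ _) ∣f₁∣≡1 bound) (row₂-empty-successor⇒∣f∣≤1 mg j≡1+j′ empty)
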